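{- For all $n\geq1$, $$B_{n-1}^{neobc}B_{n+1}^{neobc}-(B_{n}^{neobc})^{2}=\frac{3B_{n+1}^{neobc}-6B_{n}^{neobc}+3B_{n-1}^{neobc}-648}{4},$$ $$C_{n-1}^{neobc}C_{n+1}^{neobc}-(C_{n}^{neobc})^{2}=1296,$$ $$R_{n-1}^{neobc}R_{n+1}^{neobc}-(R_{n}^{neobc})^{2}=\frac{ -5R_{n+1}^{neobc}+10R_{n}^{neobc}-5R_{n-1}^{neobc}+648}{4},$$ and for all $n\geq2$, $$CR_{n-1}^{neobc}CR_{n+1}^{neobc}-(CR_{n}^{neobc})^{2}=-324.$$
   Context: A positive integer $m$ is a neo balcobalancing number if there is a positive integer $r$ (its neo balcobalancer) such that $(1+2+\cdots+(m-1))+(1+2+\cdots+m)=2[(m-1)+m+(m+1)+(m+2)+\cdots+(m+r)]$; then $r=\frac{ -2m-1+\sqrt{8m^2-12m+9}}{2}$ (equivalently, $m$ is a neo balcobalancing number iff $8m^2-12m+9$ is a perfect square). For $n\ge1$, $B_n^{neobc}$ denotes the $n$-th neo balcobalancing number in increasing order, $R_n^{neobc}$ its neo balcobalancer, $C_n^{neobc}=\sqrt{8(B_n^{neobc})^2-12B_n^{neobc}+9}$ and $CR_n^{neobc}=\sqrt{2(R_n^{neobc})^2+5R_n^{neobc}+2}$. By convention, $B_0^{neobc}=0$, $R_0^{neobc}=1$, $C_0^{neobc}=CR_0^{neobc}=3$. -}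

module Defs where

open import Data.Nat using (ℕ; zero; suc; _+_; _*_; _∸_; _≤_; _<_; _≥_)
open import Data.Integer as ℤ using (ℤ; +_)
open import Data.Product using (Σ; _×_; ∃; ∃-syntax)
open import Data.Sum using (_⊎_)
open import Relation.Binary.PropositionalEquality using (_≡_)
open import Relation.Nullary using (¬_)

tri : ℕ → ℕ
tri zero    = 0
tri (suc n) = suc n + tri n

sumFrom : ℕ → ℕ → ℕ
sumFrom a zero    = 0
sumFrom a (suc l) = a + sumFrom (suc a) l

NeoBalcobalancer : ℕ → ℕ → Set
NeoBalcobalancer m r =
  (1 ≤ m) × (1 ≤ r) × (tri (m ∸ 1) + tri m ≡ 2 * sumFrom (m ∸ 1) (r + 2))

IsNeoBalcobalancing : ℕ → Set
IsNeoBalcobalancing m = ∃[ r ] NeoBalcobalancer m r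

-- NthNeoBC n m : m = B_n^{neobc}  (with the convention B_0 = 0);
-- B_{n+1} is the least neo balcobalancing number exceeding B_n.
data NthNeoBC : ℕ → ℕ → Set where
  nth-zero : NthNeoBC 0 0
  nth-suc  : ∀ {n m m'} → NthNeoBC n m → m < m' → IsNeoBalcobalancing m' →
             (∀ k → m < k → k < m' → ¬ IsNeoBalcobalancing k) →
             NthNeoBC (suc n) m'

NthR : ℕ → ℕ → Set
NthR n r = (n ≡ 0 × r ≡ 1) ⊎ (1 ≤ n × ∃[ b ] (NthNeoBC n b × NeoBalcobalancer b r))

-- NthC n c : c = C_n^{neobc} = √(8 B_n² − 12 B_n + 9)  (C_0 = 3 agrees)
NthC : ℕ → ℕ → Set
NthC n c = ∃[ b ] (NthNeoBC n b ×
  ((+ c) ℤ.* (+ c) ≡ (+ 8) ℤ.* (+ b) ℤ.* (+ b) ℤ.- (+ 12) ℤ.* (+ b) ℤ.+ (+ 9)))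

-- NthCR n c : c = CR_n^{neobc} = √(2 R_n² + 5 R_n + 2)  (CR_0 = 3 agrees)
NthCR : ℕ → ℕ → Set
NthCR n c = ∃[ r ] (NthR n r × (c * c ≡ 2 * r * r + 5 * r + 2))

module Submission where

-- Summing the two arithmetic progressions turns the defining equation into m² = (r + 2)(2m + r − 1),
-- and x = 4m − 3, y = 2m + 2r + 1 turn this into the Pell-type equation x² + 9 = 2y².  By descent
-- along the automorphism (x, y) ↦ (3x − 4y, 3y − 2x), every solution of the latter lies on the orbit
-- of (3, 3) under (x, y) ↦ (3x + 4y, 2x + 3y); the orbit alternates between x ≡ 3 and x ≡ 1 (mod 4),
-- so the neo balcobalancing numbers and their balancers are produced by iterating the affine map
-- (B, R − 1) ↦ (29B + 12(R − 1) + 6, 12B + 5(R − 1)), the square of the orbit step.  Its linear part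
-- has trace 34 and determinant 1, so every affine combination u of B and R satisfies
-- u(n+2) + u(n) = 34 u(n+1) + c, and then u(n) u(n+2) − u(n+1)² + c u(n+1) does not depend on n.

open import Data.Empty using (⊥; ⊥-elim)
open import Data.List.Base using (_∷_; [])
open import Data.Nat.Base as ℕ
  using (ℕ; zero; suc; pred; _≤_; _<_; _∸_; z≤n; s≤s; _≤′_; ≤′-refl; ≤′-step)
open import Data.Nat.Properties
open import Data.Nat.Induction using (<-rec)
open import Data.Nat.DivMod using (_%_; [m+kn]%n≡m%n)
open import Data.Integer as ℤ using (ℤ)
import Data.Integer.Properties as ℤₚ
open import Data.Product using (_×_; _,_; ∃-syntax; map₂)
open import Data.Sum using (_⊎_; inj₁; inj₂)
open import Function.Base using (_∘_)
open import Function.Bundles using (_⇔_; mk⇔; Equivalence)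
open import Relation.Binary.Definitions using (tri<; tri≈; tri>)
open import Relation.Binary.PropositionalEquality
  using (_≡_; _≢_; refl; sym; trans; cong; cong₂; subst; subst₂; module ≡-Reasoning)
open import Relation.Nullary using (¬_; yes; no)
open import Relation.Nullary.Decidable using (toWitness; _×-dec_; _→-dec_)

open import Defs

module _ where
  open import Data.Nat.Base using (_+_; _*_)
  open import Data.Nat.Tactic.RingSolver using (solve-∀; solve)

  module StrictlyIncreasing (f : ℕ → ℕ) (f-step : ∀ n → f n < f (suc n)) where

    mono-≤ : ∀ {m n} → m ≤ n → f m ≤ f n
    mono-≤ = mono-≤′ ∘ ≤⇒≤′
      where
      mono-≤′ : ∀ {m n} → m ≤′ n → f m ≤ f n
      mono-≤′ ≤′-refl         = ≤-refl
      mono-≤′ (≤′-step m≤′n) = ≤-trans (mono-≤′ m≤′n) (<⇒≤ (f-step _))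

    cancel-≤ : ∀ {m n} → f m ≤ f n → m ≤ n
    cancel-≤ fm≤fn = ≮⇒≥ (λ n<m → <⇒≱ (<-≤-trans (f-step _) (mono-≤ n<m)) fm≤fn)

    cancel-< : ∀ {m n} → f m < f n → m < n
    cancel-< fm<fn = ≰⇒> (λ n≤m → <⇒≱ fm<fn (mono-≤ n≤m))

    injective : ∀ {m n} → f m ≡ f n → m ≡ n
    injective eq = ≤-antisym (cancel-≤ (≤-reflexive eq)) (cancel-≤ (≤-reflexive (sym eq)))

  square-step : ∀ n → n * n < suc n * suc n
  square-step n = *-mono-< (n<1+n n) (n<1+n n)

  square-cancel-≤ : ∀ {m n} → m * m ≤ n * n → m ≤ n
  square-cancel-≤ = StrictlyIncreasing.cancel-≤ (λ n → n * n) square-step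

  square-cancel-< : ∀ {m n} → m * m < n * n → m < n
  square-cancel-< = StrictlyIncreasing.cancel-< (λ n → n * n) square-step

  square-injective : ∀ {m n} → m * m ≡ n * n → m ≡ n
  square-injective = StrictlyIncreasing.injective (λ n → n * n) square-step

  tri-double : ∀ n → 2 * tri n ≡ n * suc n
  tri-double zero    = refl
  tri-double (suc n) = begin
    2 * (suc n + tri n)        ≡⟨ *-distribˡ-+ 2 (suc n) (tri n) ⟩
    2 * suc n + 2 * tri n      ≡⟨ cong ((2 * suc n) +_) (tri-double n) ⟩
    2 * (1 + n) + n * (1 + n)  ≡⟨ solve (n ∷ []) ⟩
    (1 + n) * (2 + n)          ∎
    where open ≡-Reasoning

  tri-consecutive : ∀ n → tri n + tri (suc n) ≡ suc n * suc n
  tri-consecutive n = from-double (tri n) (tri-double n)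
    where
    open ≡-Reasoning
    from-double : ∀ t → 2 * t ≡ n * suc n → t + (suc n + t) ≡ suc n * suc n
    from-double t h = begin
      t + (1 + n + t)          ≡⟨ solve (t ∷ n ∷ []) ⟩
      (1 + n) + 2 * t          ≡⟨ cong ((1 + n) +_) h ⟩
      (1 + n) + n * (1 + n)    ≡⟨ solve (n ∷ []) ⟩
      (1 + n) * (1 + n)        ∎

  sumFrom-double : ∀ a l → 2 * sumFrom a l + l ≡ l * (2 * a + l)
  sumFrom-double a zero    = refl
  sumFrom-double a (suc l) = from-shifted (sumFrom (suc a) l) (sumFrom-double (suc a) l)
    where
    open ≡-Reasoning
    from-shifted : ∀ t → 2 * t + l ≡ l * (2 * suc a + l) → 2 * (a + t) + suc l ≡ suc l * (2 * a + suc l)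
    from-shifted t h = begin
      2 * (a + t) + (1 + l)                ≡⟨ solve (a ∷ t ∷ l ∷ []) ⟩
      (2 * a + 1) + (2 * t + l)            ≡⟨ cong ((2 * a + 1) +_) h ⟩
      (2 * a + 1) + l * (2 * (1 + a) + l)  ≡⟨ solve (a ∷ l ∷ []) ⟩
      (1 + l) * (2 * a + (1 + l))          ∎

  -- v stands for r − 1, where r is the balancer, so that no truncated subtraction occurs.
  NeoBalanceEq : ℕ → ℕ → Set
  NeoBalanceEq m v = m * m ≡ (v + 3) * (2 * m + v)

  balance⇔neoBalanceEq : ∀ k v →
    (tri k + tri (suc k) ≡ 2 * sumFrom k (suc v + 2)) ⇔ NeoBalanceEq (suc k) v
  balance⇔neoBalanceEq k v = mk⇔ to from
    where
    open ≡-Reasoning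
    to : tri k + tri (suc k) ≡ 2 * sumFrom k (suc v + 2) → NeoBalanceEq (suc k) v
    to eq = +-cancelʳ-≡ (suc v + 2) _ _ (begin
      suc k * suc k + (1 + v + 2)                ≡⟨ cong (_+ (1 + v + 2)) (trans (sym (tri-consecutive k)) eq) ⟩
      2 * sumFrom k (1 + v + 2) + (1 + v + 2)    ≡⟨ sumFrom-double k (1 + v + 2) ⟩
      (1 + v + 2) * (2 * k + (1 + v + 2))        ≡⟨ solve (k ∷ v ∷ []) ⟩
      (v + 3) * (2 * (1 + k) + v) + (1 + v + 2)  ∎)
    from : NeoBalanceEq (suc k) v → tri k + tri (suc k) ≡ 2 * sumFrom k (suc v + 2)
    from eq = trans (tri-consecutive k) (+-cancelʳ-≡ (suc v + 2) _ _ (begin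
      suc k * suc k + (1 + v + 2)                ≡⟨ cong (_+ (1 + v + 2)) eq ⟩
      (v + 3) * (2 * (1 + k) + v) + (1 + v + 2)  ≡⟨ solve (k ∷ v ∷ []) ⟩
      (1 + v + 2) * (2 * k + (1 + v + 2))        ≡⟨ sym (sumFrom-double k (1 + v + 2)) ⟩
      2 * sumFrom k (1 + v + 2) + (1 + v + 2)    ∎))

  Pell : ℕ → ℕ → Set
  Pell x y = x * x + 9 ≡ 2 * (y * y)

  neoBalanceEq⇒pell : ∀ {k v} → NeoBalanceEq (suc k) v → Pell (4 * k + 1) (2 * k + 2 * v + 5)
  neoBalanceEq⇒pell {k} {v} eq = +-cancelʳ-≡ (8 * ((v + 3) * (2 * suc k + v))) _ _ (begin
    (4 * k + 1) * (4 * k + 1) + 9 + 8 * ((v + 3) * (2 * (1 + k) + v))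
      ≡⟨ solve (k ∷ v ∷ []) ⟩
    2 * ((2 * k + 2 * v + 5) * (2 * k + 2 * v + 5)) + 8 * ((1 + k) * (1 + k))
      ≡⟨ cong (λ t → 2 * ((2 * k + 2 * v + 5) * (2 * k + 2 * v + 5)) + 8 * t) eq ⟩
    2 * ((2 * k + 2 * v + 5) * (2 * k + 2 * v + 5)) + 8 * ((v + 3) * (2 * (1 + k) + v)) ∎)
    where open ≡-Reasoning

  pell-y-positive : ∀ {x y} → Pell x y → 0 < y
  pell-y-positive {x} {zero} sol with trans (+-comm 9 (x * x)) sol
  ... | ()
  pell-y-positive {y = suc _} _ = s≤s z≤n

  pell-x<9 : ∀ {x y} → y < 7 → Pell x y → x < 9
  pell-x<9 {x} {y} y<7 sol = square-cancel-< (begin-strict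
    x * x          ≤⟨ m≤m+n (x * x) 9 ⟩
    x * x + 9      ≡⟨ sol ⟩
    2 * (y * y)    ≤⟨ *-monoʳ-≤ 2 (*-mono-≤ (≤-pred y<7) (≤-pred y<7)) ⟩
    72             <⟨ m<m+n 72 {9} (s≤s z≤n) ⟩
    81             ∎)
    where open ≤-Reasoning

  pell-small : ∀ {x y} → x < 9 → y < 7 → Pell x y → x ≡ 3 × y ≡ 3
  pell-small x<9 y<7 = toWitness {a? = allUpTo? (λ x → allUpTo? (λ y →
    (x * x + 9 ≟ 2 * (y * y)) →-dec (x ≟ 3 ×-dec y ≟ 3)) 7) 9} _ x<9 y<7

  pell-2x≤3y : ∀ {x y} → Pell x y → 2 * x ≤ 3 * y
  pell-2x≤3y {x} {y} sol = square-cancel-≤ (begin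
    (2 * x) * (2 * x)        ≤⟨ m≤m+n _ 36 ⟩
    (2 * x) * (2 * x) + 36   ≡⟨ solve (x ∷ []) ⟩
    4 * (x * x + 9)          ≡⟨ cong (4 *_) sol ⟩
    4 * (2 * (y * y))        ≡⟨ solve (y ∷ []) ⟩
    8 * (y * y)              ≤⟨ m≤m+n _ (y * y) ⟩
    8 * (y * y) + y * y      ≡⟨ solve (y ∷ []) ⟩
    (3 * y) * (3 * y)        ∎)
    where open ≤-Reasoning

  pell-4y≤3x : ∀ {x y} → 7 ≤ y → Pell x y → 4 * y ≤ 3 * x
  pell-4y≤3x {x} {y} 7≤y sol = square-cancel-≤ (begin
    (4 * y) * (4 * y)        ≡⟨ solve (y ∷ []) ⟩
    8 * (2 * (y * y))        ≡⟨ cong (8 *_) (sym sol) ⟩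
    8 * (x * x + 9)          ≡⟨ solve (x ∷ []) ⟩
    8 * (x * x) + 72         ≤⟨ +-monoʳ-≤ (8 * (x * x)) 72≤x² ⟩
    8 * (x * x) + x * x      ≡⟨ solve (x ∷ []) ⟩
    (3 * x) * (3 * x)        ∎)
    where
    open ≤-Reasoning
    72≤x² : 72 ≤ x * x
    72≤x² = +-cancelʳ-≤ 9 72 (x * x) (begin
      81               ≤⟨ m≤m+n 81 17 ⟩
      2 * (7 * 7)      ≤⟨ *-monoʳ-≤ 2 (*-mono-≤ 7≤y 7≤y) ⟩
      2 * (y * y)      ≡⟨ sym sol ⟩
      x * x + 9        ∎)

  pell-unstep : ∀ {a c} → Pell (3 * a + 4 * c) (2 * a + 3 * c) → Pell a c
  pell-unstep {a} {c} sol = +-cancelʳ-≡ (2 * ((2 * a + 3 * c) * (2 * a + 3 * c))) _ _ (begin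
    a * a + 9 + 2 * ((2 * a + 3 * c) * (2 * a + 3 * c))     ≡⟨ solve (a ∷ c ∷ []) ⟩
    (3 * a + 4 * c) * (3 * a + 4 * c) + 9 + 2 * (c * c)     ≡⟨ cong (_+ 2 * (c * c)) sol ⟩
    2 * ((2 * a + 3 * c) * (2 * a + 3 * c)) + 2 * (c * c)   ≡⟨ +-comm _ (2 * (c * c)) ⟩
    2 * (c * c) + 2 * ((2 * a + 3 * c) * (2 * a + 3 * c))   ∎)
    where open ≡-Reasoning

  orbit-unstep : ∀ {x y a c} → 4 * y + a ≡ 3 * x → 2 * x + c ≡ 3 * y →
                 x ≡ 3 * a + 4 * c × y ≡ 2 * a + 3 * c
  orbit-unstep {x} {y} {a} {c} 4y+a≡3x 2x+c≡3y = x≡ , y≡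
    where
    open ≡-Reasoning
    x≡ : x ≡ 3 * a + 4 * c
    x≡ = +-cancelʳ-≡ (12 * y + 8 * x) _ _ (begin
      x + (12 * y + 8 * x)                ≡⟨ solve (x ∷ y ∷ []) ⟩
      3 * (3 * x) + 4 * (3 * y)           ≡⟨ cong₂ (λ s t → 3 * s + 4 * t) (sym 4y+a≡3x) (sym 2x+c≡3y) ⟩
      3 * (4 * y + a) + 4 * (2 * x + c)   ≡⟨ solve (x ∷ y ∷ a ∷ c ∷ []) ⟩
      3 * a + 4 * c + (12 * y + 8 * x)    ∎)
    y≡ : y ≡ 2 * a + 3 * c
    y≡ = +-cancelʳ-≡ (8 * y + 6 * x) _ _ (begin
      y + (8 * y + 6 * x)                 ≡⟨ solve (x ∷ y ∷ []) ⟩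
      2 * (3 * x) + 3 * (3 * y)           ≡⟨ cong₂ (λ s t → 2 * s + 3 * t) (sym 4y+a≡3x) (sym 2x+c≡3y) ⟩
      2 * (4 * y + a) + 3 * (2 * x + c)   ≡⟨ solve (x ∷ y ∷ a ∷ c ∷ []) ⟩
      2 * a + 3 * c + (8 * y + 6 * x)     ∎)

  pell-descent : ∀ {x y} → 7 ≤ y → Pell x y → ∃[ a ] ∃[ c ] (x ≡ 3 * a + 4 * c × y ≡ 2 * a + 3 * c)
  pell-descent {x} {y} 7≤y sol =
    descend (m≤n⇒∃[o]m+o≡n (pell-4y≤3x {x} {y} 7≤y sol)) (m≤n⇒∃[o]m+o≡n (pell-2x≤3y {x} {y} sol))
    where
    descend : ∃[ a ] 4 * y + a ≡ 3 * x → ∃[ c ] 2 * x + c ≡ 3 * y →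
              ∃[ a ] ∃[ c ] (x ≡ 3 * a + 4 * c × y ≡ 2 * a + 3 * c)
    descend (a , 4y+a≡3x) (c , 2x+c≡3y) = a , c , orbit-unstep 4y+a≡3x 2x+c≡3y

  c<2a+3c : ∀ a {c} → 0 < c → c < 2 * a + 3 * c
  c<2a+3c a {c} 0<c = begin-strict
    c                    <⟨ m<m+n c 0<c ⟩
    c + c                ≤⟨ m≤n+m (c + c) (2 * a + c) ⟩
    2 * a + c + (c + c)  ≡⟨ solve (a ∷ c ∷ []) ⟩
    2 * a + 3 * c        ∎
    where open ≤-Reasoning

  pell-x pell-y : ℕ → ℕ
  pell-x zero    = 3
  pell-x (suc i) = 3 * pell-x i + 4 * pell-y i
  pell-y zero    = 3
  pell-y (suc i) = 2 * pell-x i + 3 * pell-y i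

  pell-solutions : ∀ {x y} → Pell x y → ∃[ i ] (x ≡ pell-x i × y ≡ pell-y i)
  pell-solutions {x} {y} = <-rec P descend y x
    where
    P : ℕ → Set
    P y = ∀ x → Pell x y → ∃[ i ] (x ≡ pell-x i × y ≡ pell-y i)
    descend : ∀ y → (∀ {z} → z < y → P z) → P y
    descend y rec x sol with 7 ≤? y
    ... | no 7≰y = 0 , pell-small (pell-x<9 {x} {y} (≰⇒> 7≰y) sol) (≰⇒> 7≰y) sol
    ... | yes 7≤y = step (pell-descent {x} {y} 7≤y sol)
      where
      step : ∃[ a ] ∃[ c ] (x ≡ 3 * a + 4 * c × y ≡ 2 * a + 3 * c) → ∃[ i ] (x ≡ pell-x i × y ≡ pell-y i)
      step (a , c , x≡ , y≡) = from-predecessor (rec c<y a sol′)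
        where
        sol′ : Pell a c
        sol′ = pell-unstep {a} {c} (subst₂ Pell x≡ y≡ sol)
        c<y : c < y
        c<y = subst (c <_) (sym y≡) (c<2a+3c a (pell-y-positive {a} {c} sol′))
        from-predecessor : ∃[ i ] (a ≡ pell-x i × c ≡ pell-y i) → ∃[ i ] (x ≡ pell-x i × y ≡ pell-y i)
        from-predecessor (i , a≡ , c≡) =
          suc i , trans x≡ (cong₂ (λ s t → 3 * s + 4 * t) a≡ c≡)
                , trans y≡ (cong₂ (λ s t → 2 * s + 3 * t) a≡ c≡)

  -- (B n, V n) = (B_n, R_n − 1)
  B V : ℕ → ℕ
  B zero    = 0
  B (suc n) = 6 + (29 * B n + 12 * V n)
  V zero    = 0
  V (suc n) = 12 * B n + 5 * V n

  -- pell-x (2j) ≡ 3 (mod 4), while pell-x (2j + 1) = 4 B (j + 1) − 3.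
  pell-orbit-cases : ∀ i →
      (∃[ j ] (pell-x i ≡ 4 * (5 * B j + 2 * V j) + 3 × pell-y i ≡ 14 * B j + 6 * V j + 3))
    ⊎ (∃[ j ] (pell-x i ≡ 4 * pred (B (suc j)) + 1 × pell-y i ≡ 2 * pred (B (suc j)) + 2 * V (suc j) + 5))
  pell-orbit-cases zero = inj₁ (0 , refl , refl)
  pell-orbit-cases (suc i) with pell-orbit-cases i
  ... | inj₁ (j , x≡ , y≡) =
    inj₂ (j , trans (cong₂ (λ s t → 3 * s + 4 * t) x≡ y≡) (x-step (B j) (V j))
            , trans (cong₂ (λ s t → 2 * s + 3 * t) x≡ y≡) (y-step (B j) (V j)))
    where
    x-step : ∀ S T → 3 * (4 * (5 * S + 2 * T) + 3) + 4 * (14 * S + 6 * T + 3) ≡ 4 * (5 + (29 * S + 12 * T)) + 1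
    x-step = solve-∀
    y-step : ∀ S T → 2 * (4 * (5 * S + 2 * T) + 3) + 3 * (14 * S + 6 * T + 3)
                   ≡ 2 * (5 + (29 * S + 12 * T)) + 2 * (12 * S + 5 * T) + 5
    y-step = solve-∀
  ... | inj₂ (j , x≡ , y≡) =
    inj₁ (suc j , trans (cong₂ (λ s t → 3 * s + 4 * t) x≡ y≡) (x-step (B j) (V j))
                , trans (cong₂ (λ s t → 2 * s + 3 * t) x≡ y≡) (y-step (B j) (V j)))
    where
    x-step : ∀ S T → 3 * (4 * (5 + (29 * S + 12 * T)) + 1)
                   + 4 * (2 * (5 + (29 * S + 12 * T)) + 2 * (12 * S + 5 * T) + 5)
                   ≡ 4 * (5 * (6 + (29 * S + 12 * T)) + 2 * (12 * S + 5 * T)) + 3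
    x-step = solve-∀
    y-step : ∀ S T → 2 * (4 * (5 + (29 * S + 12 * T)) + 1)
                   + 3 * (2 * (5 + (29 * S + 12 * T)) + 2 * (12 * S + 5 * T) + 5)
                   ≡ 14 * (6 + (29 * S + 12 * T)) + 6 * (12 * S + 5 * T) + 3
    y-step = solve-∀

  4m+1≢4n+3 : ∀ m n → 4 * m + 1 ≢ 4 * n + 3
  4m+1≢4n+3 m n eq = 1≢3 (trans (sym (residue 1 m)) (trans (cong (_% 4) eq) (residue 3 n)))
    where
    residue : ∀ r q → (4 * q + r) % 4 ≡ r % 4
    residue r q = trans (cong (_% 4) (trans (+-comm (4 * q) r) (cong (r +_) (*-comm 4 q)))) ([m+kn]%n≡m%n r q 4)
    1≢3 : 1 ≢ 3
    1≢3 ()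

  neoBalanceEq-classify : ∀ {k v} → NeoBalanceEq (suc k) v → ∃[ j ] (suc k ≡ B (suc j) × v ≡ V (suc j))
  neoBalanceEq-classify {k} {v} eq = from-orbit (pell-solutions (neoBalanceEq⇒pell {k} {v} eq))
    where
    from-orbit : ∃[ i ] (4 * k + 1 ≡ pell-x i × 2 * k + 2 * v + 5 ≡ pell-y i) →
                 ∃[ j ] (suc k ≡ B (suc j) × v ≡ V (suc j))
    from-orbit (i , x≡ , y≡) with pell-orbit-cases i
    ... | inj₁ (j , x≡′ , _) = ⊥-elim (4m+1≢4n+3 k (5 * B j + 2 * V j) (trans x≡ x≡′))
    ... | inj₂ (j , x≡′ , y≡′) = j , cong suc k≡ , v≡
      where
      k≡ : k ≡ pred (B (suc j))
      k≡ = *-cancelˡ-≡ k _ 4 (+-cancelʳ-≡ 1 _ _ (trans x≡ x≡′))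
      v≡ : v ≡ V (suc j)
      v≡ = *-cancelˡ-≡ v _ 2 (+-cancelˡ-≡ (2 * k) _ _ (+-cancelʳ-≡ 5 _ _
             (trans y≡ (trans y≡′ (cong (λ t → 2 * t + 2 * V (suc j) + 5) (sym k≡))))))

  neoBalanceEq-BV : ∀ n → NeoBalanceEq (B n) (V n)
  neoBalanceEq-BV zero    = refl
  neoBalanceEq-BV (suc n) = +-cancelʳ-≡ (B n * B n) _ _ (begin
    B (suc n) * B (suc n) + B n * B n                    ≡⟨ cong (B (suc n) * B (suc n) +_) (neoBalanceEq-BV n) ⟩
    B (suc n) * B (suc n) + (V n + 3) * (2 * B n + V n)  ≡⟨ step (B n) (V n) ⟩
    (V (suc n) + 3) * (2 * B (suc n) + V (suc n)) + B n * B n ∎)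
    where
    open ≡-Reasoning
    step : ∀ S T → (6 + (29 * S + 12 * T)) * (6 + (29 * S + 12 * T)) + (T + 3) * (2 * S + T)
                 ≡ (12 * S + 5 * T + 3) * (2 * (6 + (29 * S + 12 * T)) + (12 * S + 5 * T)) + S * S
    step = solve-∀

  B-increasing : ∀ n → B n < B (suc n)
  B-increasing n = s≤s (m≤n⇒m≤o+n 5 (≤-trans (m≤n*m (B n) 29) (m≤m+n (29 * B n) (12 * V n))))

  B-cancel-< : ∀ {m n} → B m < B n → m < n
  B-cancel-< = StrictlyIncreasing.cancel-< B B-increasing

  B-injective : ∀ {m n} → B m ≡ B n → m ≡ n
  B-injective = StrictlyIncreasing.injective B B-increasing

  neoBalcobalancer-B : ∀ j → NeoBalcobalancer (B (suc j)) (suc (V (suc j)))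
  neoBalcobalancer-B j = s≤s z≤n , s≤s z≤n ,
    Equivalence.from (balance⇔neoBalanceEq (pred (B (suc j))) (V (suc j))) (neoBalanceEq-BV (suc j))

  neoBalcobalancer⇒ : ∀ {m r} → NeoBalcobalancer m r → ∃[ j ] (m ≡ B (suc j) × r ≡ suc (V (suc j)))
  neoBalcobalancer⇒ {zero}         (() , _)
  neoBalcobalancer⇒ {suc _} {zero} (_ , () , _)
  neoBalcobalancer⇒ {suc k} {suc v} (_ , _ , eq) =
    map₂ (map₂ (cong suc)) (neoBalanceEq-classify {k} {v} (Equivalence.to (balance⇔neoBalanceEq k v) eq))

  no-neo-between : ∀ n k → B n < k → k < B (suc n) → ¬ IsNeoBalcobalancing k
  no-neo-between n k lo hi (r , nb) = excluded (neoBalcobalancer⇒ nb)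
    where
    excluded : ∃[ j ] (k ≡ B (suc j) × r ≡ suc (V (suc j))) → ⊥
    excluded (j , k≡ , _) = ≤⇒≯ (m<1+n⇒m≤n (B-cancel-< {n} {suc j} (subst (B n <_) k≡ lo)))
                                 (≤-pred (B-cancel-< {suc j} {suc n} (subst (_< B (suc n)) k≡ hi)))

  next-neo-unique : ∀ n {m} → B n < m → IsNeoBalcobalancing m →
                    (∀ k → B n < k → k < m → ¬ IsNeoBalcobalancing k) → m ≡ B (suc n)
  next-neo-unique n {m} lo neo gap with <-cmp m (B (suc n))
  ... | tri< m<B _ _ = ⊥-elim (no-neo-between n m lo m<B neo)
  ... | tri≈ _ m≡B _ = m≡B
  ... | tri> _ _ B<m = ⊥-elim (gap _ (B-increasing n) B<m (_ , neoBalcobalancer-B n))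

  nth-unique : ∀ {n m} → NthNeoBC n m → m ≡ B n
  nth-unique nth-zero = refl
  nth-unique (nth-suc {n} {m} p lo neo gap) =
    next-neo-unique n (subst (_< _) m≡ lo) neo (λ k Bn<k → gap k (subst (_< k) (sym m≡) Bn<k))
    where
    m≡ : m ≡ B n
    m≡ = nth-unique p

  nthR-unique : ∀ {n r} → NthR n r → r ≡ suc (V n)
  nthR-unique (inj₁ (refl , refl)) = refl
  nthR-unique {n} {r} (inj₂ (_ , _ , p , nb)) = from-index (neoBalcobalancer⇒ nb)
    where
    from-index : ∃[ j ] (_ ≡ B (suc j) × r ≡ suc (V (suc j))) → r ≡ suc (V n)
    from-index (j , m≡ , r≡) =
      trans r≡ (cong (suc ∘ V) (sym (B-injective {n} {suc j} (trans (sym (nth-unique p)) m≡))))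

  C : ℕ → ℕ
  C n = 2 * B n + 2 * V n + 3

  -- CR n is CR_{n+1}: the conventional value CR_0 = 3 does not fit the recurrence, whence n ≥ 2 in the theorem.
  CR : ℕ → ℕ
  CR n = 17 * B n + 7 * V n + 3

  CR-square : ∀ n → let r = suc (V (suc n)) in CR n * CR n ≡ 2 * r * r + 5 * r + 2
  CR-square n = +-cancelʳ-≡ (B n * B n) _ _ (begin
    CR n * CR n + B n * B n                  ≡⟨ cong (CR n * CR n +_) (neoBalanceEq-BV n) ⟩
    CR n * CR n + (V n + 3) * (2 * B n + V n) ≡⟨ step (B n) (V n) ⟩
    _ + B n * B n ∎)
    where
    open ≡-Reasoning
    step : ∀ S T → (17 * S + 7 * T + 3) * (17 * S + 7 * T + 3) + (T + 3) * (2 * S + T)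
                 ≡ 2 * (1 + (12 * S + 5 * T)) * (1 + (12 * S + 5 * T)) + 5 * (1 + (12 * S + 5 * T)) + 2 + S * S
    step = solve-∀

  nthCR-unique : ∀ {n d} → NthCR (suc n) d → d ≡ CR n
  nthCR-unique {n} (_ , p , eq) rewrite nthR-unique p = square-injective (trans eq (sym (CR-square n)))

module _ where
  open import Data.Integer.Base using (+_; -_; _+_; _-_; _*_)
  open import Data.Integer.Tactic.RingSolver using (solve-∀; solve)
  open ≡-Reasoning

  pos-affine : ∀ p q k x y → + (p ℕ.* x ℕ.+ q ℕ.* y ℕ.+ k) ≡ + p * + x + + q * + y + + k
  pos-affine p q k x y = cong (_+ + k) (cong₂ _+_ (ℤₚ.pos-* p x) (ℤₚ.pos-* q y))

  B-suc : ∀ n → + B (suc n) ≡ + 6 + (+ 29 * + B n + + 12 * + V n)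
  B-suc n = cong (_+_ (+ 6)) (cong₂ _+_ (ℤₚ.pos-* 29 (B n)) (ℤₚ.pos-* 12 (V n)))

  V-suc : ∀ n → + V (suc n) ≡ + 12 * + B n + + 5 * + V n
  V-suc n = cong₂ _+_ (ℤₚ.pos-* 12 (B n)) (ℤₚ.pos-* 5 (V n))

  affine-recurrence : ∀ (p q k : ℤ) (u : ℕ → ℤ) → (∀ n → u n ≡ p * + B n + q * + V n + k) →
    ∀ n → u (suc (suc n)) + u n ≡ + 34 * u (suc n) + (+ 72 * q - + 24 * p - + 32 * k)
  affine-recurrence p q k u u≡ n = begin
    u (suc (suc n)) + u n
      ≡⟨ cong₂ _+_ (u≡ (suc (suc n))) (u≡ n) ⟩
    (p * + B (suc (suc n)) + q * + V (suc (suc n)) + k) + (p * + B n + q * + V n + k)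
      ≡⟨ two-steps (B-suc n) (V-suc n) (B-suc (suc n)) (V-suc (suc n)) ⟩
    + 34 * (p * + B (suc n) + q * + V (suc n) + k) + (+ 72 * q - + 24 * p - + 32 * k)
      ≡⟨ cong (λ t → + 34 * t + (+ 72 * q - + 24 * p - + 32 * k)) (sym (u≡ (suc n))) ⟩
    + 34 * u (suc n) + (+ 72 * q - + 24 * p - + 32 * k) ∎
    where
    two-steps : ∀ {S T S₁ T₁ S₂ T₂} →
      S₁ ≡ + 6 + (+ 29 * S + + 12 * T) → T₁ ≡ + 12 * S + + 5 * T →
      S₂ ≡ + 6 + (+ 29 * S₁ + + 12 * T₁) → T₂ ≡ + 12 * S₁ + + 5 * T₁ →
      (p * S₂ + q * T₂ + k) + (p * S + q * T + k)
        ≡ + 34 * (p * S₁ + q * T₁ + k) + (+ 72 * q - + 24 * p - + 32 * k)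
    two-steps {S} {T} refl refl refl refl = solve (p ∷ q ∷ k ∷ S ∷ T ∷ [])

  cassini-step : ∀ (a c x y z t : ℤ) → t + y ≡ a * z + c → z + x ≡ a * y + c →
                 y * t - z * z + c * z ≡ x * z - y * y + c * y
  cassini-step a c x y z t h₁ h₂ = begin
    y * t - z * z + c * z
      ≡⟨ solve (c ∷ x ∷ y ∷ z ∷ t ∷ []) ⟩
    y * (t + y) - z * (z + x) + (x * z - y * y + c * z)
      ≡⟨ cong₂ (λ p q → y * p - z * q + (x * z - y * y + c * z)) h₁ h₂ ⟩
    y * (a * z + c) - z * (a * y + c) + (x * z - y * y + c * z)
      ≡⟨ solve (a ∷ c ∷ x ∷ y ∷ z ∷ []) ⟩
    x * z - y * y + c * y ∎

  cassini : ∀ (u : ℕ → ℤ) (a c : ℤ) → (∀ n → u (suc (suc n)) + u n ≡ a * u (suc n) + c) →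
            ∀ n → u n * u (suc (suc n)) - u (suc n) * u (suc n) + c * u (suc n)
                ≡ u 0 * u 2 - u 1 * u 1 + c * u 1
  cassini u a c rec zero    = refl
  cassini u a c rec (suc n) =
    trans (cassini-step a c (u n) (u (suc n)) (u (suc (suc n))) (u (suc (suc (suc n)))) (rec (suc n)) (rec n))
          (cassini u a c rec n)

  BGap CGap RGap CRGap : ℤ → ℤ → ℤ → Set
  BGap x y z  = + 4 * (x * z - y * y) ≡ + 3 * z - + 6 * y + + 3 * x - + 648
  CGap x y z  = x * z - y * y ≡ + 1296
  RGap x y z  = + 4 * (x * z - y * y) ≡ - (+ 5 * z) + + 10 * y - + 5 * x + + 648
  CRGap x y z = x * z - y * y ≡ - (+ 324)

  B-recurrence : ∀ n → + B (suc (suc n)) + + B n ≡ + 34 * + B (suc n) + - (+ 24)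
  B-recurrence = affine-recurrence (+ 1) (+ 0) (+ 0) (λ n → + B n) (λ n → as-affine (+ B n) (+ V n))
    where
    as-affine : ∀ S T → S ≡ + 1 * S + + 0 * T + + 0
    as-affine = solve-∀

  B-gap : ∀ n → BGap (+ B n) (+ B (suc n)) (+ B (suc (suc n)))
  B-gap n = rearrange (+ B n) (+ B (suc n)) (+ B (suc (suc n)))
    (cassini (λ n → + B n) (+ 34) (- (+ 24)) B-recurrence n) (B-recurrence n)
    where
    rearrange : ∀ x y z → x * z - y * y + - (+ 24) * y ≡ - (+ 180) → z + x ≡ + 34 * y + - (+ 24) → BGap x y z
    rearrange x y z h r = begin
      + 4 * (x * z - y * y)                             ≡⟨ solve (x ∷ y ∷ z ∷ []) ⟩
      + 4 * (x * z - y * y + - (+ 24) * y) + + 96 * y   ≡⟨ cong (λ t → + 4 * t + + 96 * y) h ⟩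
      + 4 * - (+ 180) + + 96 * y                        ≡⟨ solve (y ∷ []) ⟩
      + 3 * (+ 34 * y + - (+ 24)) - + 6 * y - + 648     ≡⟨ cong (λ t → + 3 * t - + 6 * y - + 648) (sym r) ⟩
      + 3 * (z + x) - + 6 * y - + 648                   ≡⟨ solve (x ∷ y ∷ z ∷ []) ⟩
      + 3 * z - + 6 * y + + 3 * x - + 648               ∎

  R-recurrence : ∀ n → + suc (V (suc (suc n))) + + suc (V n) ≡ + 34 * + suc (V (suc n)) + + 40
  R-recurrence = affine-recurrence (+ 0) (+ 1) (+ 1) (λ n → + suc (V n)) (λ n → as-affine (+ B n) (+ V n))
    where
    as-affine : ∀ S T → + 1 + T ≡ + 0 * S + + 1 * T + + 1
    as-affine = solve-∀

  R-gap : ∀ n → RGap (+ suc (V n)) (+ suc (V (suc n))) (+ suc (V (suc (suc n))))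
  R-gap n = rearrange (+ suc (V n)) (+ suc (V (suc n))) (+ suc (V (suc (suc n))))
    (cassini (λ n → + suc (V n)) (+ 34) (+ 40) R-recurrence n) (R-recurrence n)
    where
    rearrange : ∀ x y z → x * z - y * y + + 40 * y ≡ + 112 → z + x ≡ + 34 * y + + 40 → RGap x y z
    rearrange x y z h r = begin
      + 4 * (x * z - y * y)                            ≡⟨ solve (x ∷ y ∷ z ∷ []) ⟩
      + 4 * (x * z - y * y + + 40 * y) - + 160 * y     ≡⟨ cong (λ t → + 4 * t - + 160 * y) h ⟩
      + 4 * + 112 - + 160 * y                          ≡⟨ solve (y ∷ []) ⟩
      - (+ 5 * (+ 34 * y + + 40)) + + 10 * y + + 648   ≡⟨ cong (λ t → - (+ 5 * t) + + 10 * y + + 648) (sym r) ⟩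
      - (+ 5 * (z + x)) + + 10 * y + + 648             ≡⟨ solve (x ∷ y ∷ z ∷ []) ⟩
      - (+ 5 * z) + + 10 * y - + 5 * x + + 648         ∎

  C-recurrence : ∀ n → + C (suc (suc n)) + + C n ≡ + 34 * + C (suc n) + + 0
  C-recurrence = affine-recurrence (+ 2) (+ 2) (+ 3) (λ n → + C n) (λ n → pos-affine 2 2 3 (B n) (V n))

  C-gap : ∀ n → CGap (+ C n) (+ C (suc n)) (+ C (suc (suc n)))
  C-gap n = trans (sym (ℤₚ.+-identityʳ _)) (cassini (λ n → + C n) (+ 34) (+ 0) C-recurrence n)

  CR-recurrence : ∀ n → + CR (suc (suc n)) + + CR n ≡ + 34 * + CR (suc n) + + 0
  CR-recurrence = affine-recurrence (+ 17) (+ 7) (+ 3) (λ n → + CR n) (λ n → pos-affine 17 7 3 (B n) (V n))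

  CR-gap : ∀ n → CRGap (+ CR n) (+ CR (suc n)) (+ CR (suc (suc n)))
  CR-gap n = trans (sym (ℤₚ.+-identityʳ _)) (cassini (λ n → + CR n) (+ 34) (+ 0) CR-recurrence n)

  neoBalanceEq-ℤ : ∀ n → + B n * + B n ≡ (+ V n + + 3) * (+ 2 * + B n + + V n)
  neoBalanceEq-ℤ n = begin
    + B n * + B n                                   ≡⟨ sym (ℤₚ.pos-* (B n) (B n)) ⟩
    + (B n ℕ.* B n)                                 ≡⟨ cong +_ (neoBalanceEq-BV n) ⟩
    + ((V n ℕ.+ 3) ℕ.* (2 ℕ.* B n ℕ.+ V n))         ≡⟨ ℤₚ.pos-* (V n ℕ.+ 3) (2 ℕ.* B n ℕ.+ V n) ⟩
    + (V n ℕ.+ 3) * + (2 ℕ.* B n ℕ.+ V n)           ≡⟨ cong (λ t → (+ V n + + 3) * (t + + V n)) (ℤₚ.pos-* 2 (B n)) ⟩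
    (+ V n + + 3) * (+ 2 * + B n + + V n)           ∎

  C-square : ∀ n → + C n * + C n ≡ + 8 * + B n * + B n - + 12 * + B n + + 9
  C-square n = trans (cong₂ _*_ (pos-affine 2 2 3 (B n) (V n)) (pos-affine 2 2 3 (B n) (V n)))
                     (modulo-invariant (+ B n) (+ V n) (neoBalanceEq-ℤ n))
    where
    modulo-invariant : ∀ S T → S * S ≡ (T + + 3) * (+ 2 * S + T) →
      (+ 2 * S + + 2 * T + + 3) * (+ 2 * S + + 2 * T + + 3) ≡ + 8 * S * S - + 12 * S + + 9
    modulo-invariant S T inv = begin
      (+ 2 * S + + 2 * T + + 3) * (+ 2 * S + + 2 * T + + 3)
        ≡⟨ solve (S ∷ T ∷ []) ⟩
      + 8 * S * S - + 12 * S + + 9 + + 4 * ((T + + 3) * (+ 2 * S + T) - S * S)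
        ≡⟨ cong (λ t → + 8 * S * S - + 12 * S + + 9 + + 4 * ((T + + 3) * (+ 2 * S + T) - t)) inv ⟩
      + 8 * S * S - + 12 * S + + 9 + + 4 * ((T + + 3) * (+ 2 * S + T) - (T + + 3) * (+ 2 * S + T))
        ≡⟨ solve (S ∷ T ∷ []) ⟩
      + 8 * S * S - + 12 * S + + 9 ∎

  nthC-unique : ∀ {n c} → NthC n c → c ≡ C n
  nthC-unique {n} {c} (_ , p , eq) rewrite nth-unique p = square-injective (ℤₚ.+-injective (begin
    + (c ℕ.* c)                                   ≡⟨ ℤₚ.pos-* c c ⟩
    + c * + c                                     ≡⟨ eq ⟩
    + 8 * + B n * + B n - + 12 * + B n + + 9      ≡⟨ sym (C-square n) ⟩
    + C n * + C n                                 ≡⟨ sym (ℤₚ.pos-* (C n) (C n)) ⟩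
    + (C n ℕ.* C n)                               ∎))

open import Data.Nat.Base using (_+_)
open import Data.Integer.Base using (+_; -_)

consecutive : ∀ {Nth : ℕ → ℕ → Set} {u : ℕ → ℕ} → (∀ {n x} → Nth n x → x ≡ u n) →
  (P : ℤ → ℤ → ℤ → Set) → (∀ n → P (+ u n) (+ u (suc n)) (+ u (suc (suc n)))) →
  ∀ n → 1 ≤ n → ∀ x₀ x₁ x₂ → Nth (n ∸ 1) x₀ → Nth n x₁ → Nth (n + 1) x₂ →
  P (+ x₀) (+ x₁) (+ x₂)
consecutive uniq P holds (suc n) _ x₀ x₁ x₂ p₀ p₁ p₂
  rewrite uniq p₀ | uniq p₁ | uniq p₂ | +-comm n 1 = holds n

theorem8p1 : (∀ (n : ℕ) → 1 ≤ n → ∀ (b₀ b₁ b₂ : ℕ) →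
    NthNeoBC (n ∸ 1) b₀ → NthNeoBC n b₁ → NthNeoBC (n + 1) b₂ →
    (+ 4) ℤ.* ((+ b₀) ℤ.* (+ b₂) ℤ.- (+ b₁) ℤ.* (+ b₁))
    ≡ (+ 3) ℤ.* (+ b₂) ℤ.- (+ 6) ℤ.* (+ b₁) ℤ.+ (+ 3) ℤ.* (+ b₀) ℤ.- (+ 648))
    × (∀ (n : ℕ) → 1 ≤ n → ∀ (c₀ c₁ c₂ : ℕ) →
    NthC (n ∸ 1) c₀ → NthC n c₁ → NthC (n + 1) c₂ →
    (+ c₀) ℤ.* (+ c₂) ℤ.- (+ c₁) ℤ.* (+ c₁) ≡ + 1296)
    × (∀ (n : ℕ) → 1 ≤ n → ∀ (r₀ r₁ r₂ : ℕ) →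
    NthR (n ∸ 1) r₀ → NthR n r₁ → NthR (n + 1) r₂ →
    (+ 4) ℤ.* ((+ r₀) ℤ.* (+ r₂) ℤ.- (+ r₁) ℤ.* (+ r₁))
    ≡ - ((+ 5) ℤ.* (+ r₂)) ℤ.+ (+ 10) ℤ.* (+ r₁) ℤ.- (+ 5) ℤ.* (+ r₀) ℤ.+ (+ 648))
    × (∀ (n : ℕ) → 2 ≤ n → ∀ (d₀ d₁ d₂ : ℕ) →
    NthCR (n ∸ 1) d₀ → NthCR n d₁ → NthCR (n + 1) d₂ →
    (+ d₀) ℤ.* (+ d₂) ℤ.- (+ d₁) ℤ.* (+ d₁) ≡ - (+ 324))
theorem8p1 =
    consecutive {u = B} nth-unique BGap B-gap
  , consecutive {u = C} nthC-unique CGap C-gap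
  , consecutive {u = λ n → suc (V n)} nthR-unique RGap R-gap
  , λ { (suc (suc n)) _ → consecutive {λ n → NthCR (suc n)} {CR} nthCR-unique CRGap CR-gap (suc n) (s≤s z≤n)
      ; (suc zero) (s≤s ())
      }
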